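{- Let $Q$ be a key with vertices $\{k,k'\}$ and let $r\neq k,k'$ be a vertex, and set $P=\mu_r(Q)$. If $r$ is neither a sink nor a source in $Q$, then $P$ is a pre-fork with vertices $\{r,k,k'\}$, $|P_1|>|Q_1|$, and $p_{kk'}=q_{kk'}$. If $r$ is a sink or a source in $Q$, then $P$ is a key with vertices $\{k,k'\}$, $|P_1|=|Q_1|$, and $p_{kk'}=q_{kk'}$.
   Context: A quiver is a finite directed multigraph with vertex set $Q_0$ and arrow set $Q_1$, no loops and no 2-cycles; $|Q_1|$ is the total number of arrows; $q_{ij}$ is the number of arrows $i\to j$ if positive and minus the number of arrows $j\to i$ otherwise. Mutation $\mu_v$: $q'_{ab}=-q_{ab}$ if $v\in\{a,b\}$, else $q'_{ab}=q_{ab}+\max(q_{av},0)\max(q_{vb},0)-\max(q_{bv},0)\max(q_{va},0)$. $Q\setminus V$ is the full subquiver on the vertices not in $V$. Abundant: at least two arrows between every pair of distinct vertices; acyclic: no directed cycle; source (sink): only outgoing (incoming) arrows; $F^+(v)=\{j:f_{vj}>0\}$, $F^-(v)=\{j:f_{jv}>0\}$. A fork is an abundant, non-acyclic quiver $F$ with a vertex $r$ (point of return) such that for all $i\in F^-(r)$, $j\in F^+(r)$: $f_{ji}>f_{ir}$ and $f_{ji}>f_{rj}$, and the full subquivers on $F^-(r)$, $F^+(r)$ are acyclic. Both a key with vertices $\{k,k'\}$ and a pre-fork with vertices $\{r,k,k'\}$ require $k\ne k'$ and that for each vertex $i\notin\{k,k'\}$ either ($k\to i$ and $k'\to i$) or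 ($i\to k$ and $i\to k'$) (any number, possibly zero, of arrows between $k$ and $k'$); for a key, additionally $Q\setminus\{k\}$ and $Q\setminus\{k'\}$ are abundant acyclic; for a pre-fork $P$, additionally $P\setminus\{k\}$ and $P\setminus\{k'\}$ are forks with common point of return $r$. -}

module Defs where

open import Data.Nat as ℕ using (ℕ)
open import Data.Integer as ℤ using (ℤ; +_; -_; _⊔_; _<_; _≤_)
open import Data.Fin using (Fin; zero; suc; _≟_)
open import Data.Product using (_×_; Σ; ∃)
open import Data.Sum using (_⊎_)
open import Relation.Nullary using (¬_; yes; no)
open import Relation.Binary.PropositionalEquality using (_≡_; _≢_)
open import Relation.Binary.Construct.Closure.Transitive using (TransClosure)

-- A quiver on vertex set Fin n, encoded by its exchange data q i j
-- (number of arrows i → j if positive, minus number of arrows j → i otherwise).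
Quiver : ℕ → Set
Quiver n = Fin n → Fin n → ℤ

-- Well-formedness: skew-symmetry (this forces q i i = 0, i.e. no loops;
-- 2-cycles are excluded by the encoding).
IsQuiver : ∀ {n} → Quiver n → Set
IsQuiver {n} q = ∀ (i j : Fin n) → q j i ≡ - q i j

pos : ℤ → ℤ
pos x = x ⊔ + 0

posℕ : ℤ → ℕ
posℕ (+ m) = m
posℕ ℤ.-[1+ m ] = 0

sumFin : ∀ {n} → (Fin n → ℕ) → ℕ
sumFin {ℕ.zero} f = 0
sumFin {ℕ.suc n} f = f zero ℕ.+ sumFin (λ i → f (suc i))

numArrows : ∀ {n} → Quiver n → ℕ
numArrows q = sumFin (λ i → sumFin (λ j → posℕ (q i j)))

μ : ∀ {n} → Fin n → Quiver n → Quiver n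
μ v q a b with v ≟ a | v ≟ b
... | yes _ | _     = - q a b
... | no _  | yes _ = - q a b
... | no _  | no _  = q a b ℤ.+ pos (q a v) ℤ.* pos (q v b) ℤ.- pos (q b v) ℤ.* pos (q v a)

-- vertex subsets as predicates (full subquiver on S)
VSet : ℕ → Set₁
VSet n = Fin n → Set

without : ∀ {n} → Fin n → VSet n
without k i = i ≢ k

Arrow : ∀ {n} → Quiver n → VSet n → Fin n → Fin n → Set
Arrow q S i j = S i × S j × (+ 0 < q i j)

Abundant : ∀ {n} → Quiver n → VSet n → Set
Abundant q S = ∀ i j → S i → S j → i ≢ j → (+ 2 ≤ q i j) ⊎ (+ 2 ≤ q j i)

Acyclic : ∀ {n} → Quiver n → VSet n → Set
Acyclic q S = ∀ i → ¬ TransClosure (Arrow q S) i i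

InNbr : ∀ {n} → Quiver n → VSet n → Fin n → VSet n
InNbr q S r j = S j × (+ 0 < q j r)

OutNbr : ∀ {n} → Quiver n → VSet n → Fin n → VSet n
OutNbr q S r j = S j × (+ 0 < q r j)

IsForkWith : ∀ {n} → Quiver n → VSet n → Fin n → Set
IsForkWith q S r =
  S r × Abundant q S × ¬ Acyclic q S
  × (∀ i j → InNbr q S r i → OutNbr q S r j → (q i r < q j i) × (q r j < q j i))
  × Acyclic q (InNbr q S r) × Acyclic q (OutNbr q S r)

KeyCondition : ∀ {n} → Quiver n → Fin n → Fin n → Set
KeyCondition q k k' =
  k ≢ k' ×
  (∀ i → i ≢ k → i ≢ k' →
     ((+ 0 < q k i) × (+ 0 < q k' i)) ⊎ ((+ 0 < q i k) × (+ 0 < q i k')))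

IsKey : ∀ {n} → Quiver n → Fin n → Fin n → Set
IsKey q k k' =
  KeyCondition q k k'
  × (Abundant q (without k) × Acyclic q (without k))
  × (Abundant q (without k') × Acyclic q (without k'))

IsPreFork : ∀ {n} → Quiver n → Fin n → Fin n → Fin n → Set
IsPreFork q r k k' =
  KeyCondition q k k'
  × IsForkWith q (without k) r
  × IsForkWith q (without k') r

IsSink : ∀ {n} → Quiver n → Fin n → Set
IsSink q v = ∀ j → q v j ≤ + 0

IsSource : ∀ {n} → Quiver n → Fin n → Set
IsSource q v = ∀ j → q j v ≤ + 0

-- Because Q ∖ {k} and Q ∖ {k'} are acyclic and r sees k and k' from the same side,
-- Q has no oriented triangle a → b → r → a.  Hence mutation at r reverses the arrows
-- at r and, away from r, only adds one arrow a → b for every path a → r → b.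
-- If r is a sink or a source nothing is added: abundance, the arrow count and
-- acyclicity survive (a cycle of μ_r Q cannot pass through r, which became a source
-- or a sink).  Otherwise, for j → r → i the new arrows close the oriented cycle
-- j → i → r → j, the q_jr q_ri ≥ 2 max(q_jr, q_ri) added arrows give the fork
-- inequalities, and nothing changes between two neighbours on the same side of r,
-- so these neighbourhoods stay acyclic.
module Submission where

open import Defs
open import Data.Nat using (_<_)
open import Data.Fin using (Fin)
open import Data.Product using (_×_)
open import Data.Sum using (_⊎_)
open import Relation.Nullary using (¬_)
open import Relation.Binary.PropositionalEquality using (_≡_; _≢_)

open import Data.Nat as ℕ using (ℕ; zero; suc; z≤n; s≤s)
import Data.Nat.Properties as ℕP
open import Data.Integer as ℤ using (+_; -[1+_]; +≤+; +<+; -≤-; -≤+)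
import Data.Integer.Properties as ℤP
import Data.Fin as F
import Data.Fin.Properties as FP
open import Data.Product as Prod using (_,_; proj₁; proj₂; Σ-syntax)
open import Data.Sum as Sum using (inj₁; inj₂)
open import Data.Empty using (⊥; ⊥-elim)
open import Relation.Nullary using (Dec; yes; no)
open import Relation.Binary.PropositionalEquality
  using (refl; sym; trans; cong; cong₂; subst; subst₂; ≢-sym; module ≡-Reasoning)
open import Relation.Binary.Construct.Closure.Transitive using (TransClosure; [_]; _∷_)
open import Algebra.Properties.CommutativeMonoid.Sum ℕP.+-0-commutativeMonoid
  using (sum; sum-cong-≗; ∑-distrib-+; ∑-comm)

infix 4 _⟶⟨_⟩_
_⟶⟨_⟩_ : ∀ {n} → Fin n → Quiver n → Fin n → Set
a ⟶⟨ q ⟩ b = + 0 ℤ.< q a b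

pos≡+posℕ : ∀ x → pos x ≡ + posℕ x
pos≡+posℕ (+ m) = cong +_ (ℕP.⊔-identityʳ m)
pos≡+posℕ -[1+ m ] = refl

posℕ-positive : ∀ {x} → + 0 ℤ.< x → 0 ℕ.< posℕ x
posℕ-positive (+<+ 0<m) = 0<m

posℕ-nonpositive : ∀ {x} → ¬ (+ 0 ℤ.< x) → posℕ x ≡ 0
posℕ-nonpositive {+ zero} _ = refl
posℕ-nonpositive {+ suc m} x≯0 = ⊥-elim (x≯0 (+<+ (s≤s z≤n)))
posℕ-nonpositive { -[1+ m ]} _ = refl

posℕ-mono-≤ : ∀ {x y} → x ℤ.≤ y → posℕ x ℕ.≤ posℕ y
posℕ-mono-≤ (-≤- _) = z≤n
posℕ-mono-≤ -≤+ = z≤n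
posℕ-mono-≤ (+≤+ m≤n) = m≤n

posℕ-<-+ : ∀ {x} m → + 0 ℤ.≤ x → 0 ℕ.< m → posℕ x ℕ.< posℕ (x ℤ.+ + m)
posℕ-<-+ {+ k} m _ 0<m = ℕP.m<m+n k 0<m

2≤⇒0< : ∀ {x} → + 2 ℤ.≤ x → + 0 ℤ.< x
2≤⇒0< = ℤP.<-≤-trans (+<+ (s≤s z≤n))

-- The fork inequalities: the q_jr q_ri arrows added from j to i outnumber both factors.
<-+-posℕ-* : ∀ {u x w} → + 0 ℤ.≤ w → + 2 ℤ.≤ u → + 2 ℤ.≤ x →
  (u ℤ.< w ℤ.+ + (posℕ x ℕ.* posℕ u)) × (x ℤ.< w ℤ.+ + (posℕ x ℕ.* posℕ u))
<-+-posℕ-* {+ u} {+ x} {+ w} _ (+≤+ 2≤u) (+≤+ 2≤x) =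
  +<+ (ℕP.<-≤-trans u<x*u (ℕP.m≤n+m (x ℕ.* u) w)) , +<+ (ℕP.<-≤-trans x<x*u (ℕP.m≤n+m (x ℕ.* u) w))
  where
  u<x*u : u ℕ.< x ℕ.* u
  u<x*u = subst (u ℕ.<_) (ℕP.*-comm u x)
    (ℕP.m<m*n u x {{ℕ.>-nonZero (ℕP.<-≤-trans (s≤s z≤n) 2≤u)}} 2≤x)
  x<x*u : x ℕ.< x ℕ.* u
  x<x*u = ℕP.m<m*n x u {{ℕ.>-nonZero (ℕP.<-≤-trans (s≤s z≤n) 2≤x)}} 2≤u

sum-mono-≤ : ∀ {n} {f g : Fin n → ℕ} → (∀ i → f i ℕ.≤ g i) → sum f ℕ.≤ sum g
sum-mono-≤ {zero} _ = z≤n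
sum-mono-≤ {suc n} f≤g = ℕP.+-mono-≤ (f≤g F.zero) (sum-mono-≤ (λ i → f≤g (F.suc i)))

sum-mono-< : ∀ {n} {f g : Fin n → ℕ} → (∀ i → f i ℕ.≤ g i) →
  ∀ i → f i ℕ.< g i → sum f ℕ.< sum g
sum-mono-< f≤g F.zero fi<gi = ℕP.+-mono-<-≤ fi<gi (sum-mono-≤ (λ i → f≤g (F.suc i)))
sum-mono-< f≤g (F.suc i) fi<gi =
  ℕP.+-mono-≤-< (f≤g F.zero) (sum-mono-< (λ i → f≤g (F.suc i)) i fi<gi)

arrowsBetween : ∀ {n} → Quiver n → Fin n → Fin n → ℕ
arrowsBetween q a b = posℕ (q a b) ℕ.+ posℕ (q b a)

sumFin≡sum : ∀ {n} (f : Fin n → ℕ) → sumFin f ≡ sum f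
sumFin≡sum {zero} f = refl
sumFin≡sum {suc n} f = cong (f F.zero ℕ.+_) (sumFin≡sum (λ i → f (F.suc i)))

sumFin²≡sum² : ∀ {n} (f : Fin n → Fin n → ℕ) →
  sumFin (λ a → sumFin (f a)) ≡ sum (λ a → sum (f a))
sumFin²≡sum² f = trans (sumFin≡sum (λ a → sumFin (f a))) (sum-cong-≗ (λ a → sumFin≡sum (f a)))

double-numArrows : ∀ {n} (q : Quiver n) →
  2 ℕ.* numArrows q ≡ sum (λ a → sum (arrowsBetween q a))
double-numArrows q = begin
  2 ℕ.* N
    ≡⟨ cong (N ℕ.+_) (ℕP.+-identityʳ N) ⟩
  N ℕ.+ N
    ≡⟨ cong₂ ℕ._+_ (sumFin²≡sum² arrows) (sumFin²≡sum² arrows) ⟩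
  sum (λ a → sum (λ b → posℕ (q a b))) ℕ.+ sum (λ a → sum (λ b → posℕ (q a b)))
    ≡⟨ cong (sum (λ a → sum (λ b → posℕ (q a b))) ℕ.+_) (∑-comm arrows) ⟩
  sum (λ a → sum (λ b → posℕ (q a b))) ℕ.+ sum (λ a → sum (λ b → posℕ (q b a)))
    ≡⟨ ∑-distrib-+ (λ a → sum (λ b → posℕ (q a b))) (λ a → sum (λ b → posℕ (q b a))) ⟨
  sum (λ a → sum (λ b → posℕ (q a b)) ℕ.+ sum (λ b → posℕ (q b a)))
    ≡⟨ sum-cong-≗ (λ a → ∑-distrib-+ (λ b → posℕ (q a b)) (λ b → posℕ (q b a))) ⟨
  sum (λ a → sum (arrowsBetween q a)) ∎
  where
  open ≡-Reasoning
  N : ℕ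
  N = numArrows q
  arrows : Fin _ → Fin _ → ℕ
  arrows a b = posℕ (q a b)

numArrows-< : ∀ {n} {q p : Quiver n} → (∀ a b → arrowsBetween q a b ℕ.≤ arrowsBetween p a b) →
  ∀ a b → arrowsBetween q a b ℕ.< arrowsBetween p a b → numArrows q ℕ.< numArrows p
numArrows-< {q = q} {p} q≤p a b q<p = ℕP.*-cancelˡ-< 2 _ _
  (subst₂ ℕ._<_ (sym (double-numArrows q)) (sym (double-numArrows p))
    (sum-mono-< (λ a → sum-mono-≤ (q≤p a)) a (sum-mono-< (q≤p a) b q<p)))

numArrows-cong : ∀ {n} {q p : Quiver n} → (∀ a b → arrowsBetween p a b ≡ arrowsBetween q a b) →
  numArrows p ≡ numArrows q
numArrows-cong {q = q} {p} p≡q = ℕP.*-cancelˡ-≡ _ _ 2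
  (trans (double-numArrows p)
    (trans (sum-cong-≗ (λ a → sum-cong-≗ (p≡q a))) (sym (double-numArrows q))))

Acyclic⇒¬triangle : ∀ {n} {q : Quiver n} {S : VSet n} → Acyclic q S →
  ∀ {a b c} → S a → S b → S c → a ⟶⟨ q ⟩ b → b ⟶⟨ q ⟩ c → ¬ c ⟶⟨ q ⟩ a
Acyclic⇒¬triangle acyclic {a} sa sb sc a⟶b b⟶c c⟶a =
  acyclic a ((sa , sb , a⟶b) ∷ (sb , sc , b⟶c) ∷ [ sc , sa , c⟶a ])

Acyclic-transfer : ∀ {n} {q p : Quiver n} {S T : VSet n} → (∀ {a} → T a → S a) →
  (∀ {a b} → T a → T b → a ⟶⟨ p ⟩ b → a ⟶⟨ q ⟩ b) → Acyclic q S → Acyclic p T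
Acyclic-transfer {q = q} {p} {S} {T} T⊆S arrow acyclic x cycle = acyclic x (transfer cycle)
  where
  transfer : ∀ {a b} → TransClosure (Arrow p T) a b → TransClosure (Arrow q S) a b
  transfer [ ta , tb , a⟶b ] = [ T⊆S ta , T⊆S tb , arrow ta tb a⟶b ]
  transfer ((ta , tb , a⟶b) ∷ path) = (T⊆S ta , T⊆S tb , arrow ta tb a⟶b) ∷ transfer path

module _ {A : Set} {R R' : A → A → Set} (v : A)
         (transfer : ∀ {x y} → v ≢ x → v ≢ y → R x y → R' x y) where

  cycle-avoiding-sink : (∀ {x} → ¬ R x v) → ∀ {x} → TransClosure R x x → TransClosure R' x x
  cycle-avoiding-sink no-in cycle = from (target≢ cycle) cycle
    where
    target≢ : ∀ {x y} → TransClosure R x y → v ≢ y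
    target≢ [ e ] refl = no-in e
    target≢ (_ ∷ path) = target≢ path
    from : ∀ {x y} → v ≢ x → TransClosure R x y → TransClosure R' x y
    from v≢x [ e ] = [ transfer v≢x (target≢ [ e ]) e ]
    from v≢x (e ∷ path) = transfer v≢x (target≢ [ e ]) e ∷ from (target≢ [ e ]) path

  cycle-avoiding-source : (∀ {y} → ¬ R v y) → ∀ {x} → TransClosure R x x → TransClosure R' x x
  cycle-avoiding-source no-out cycle = to (source≢ cycle) cycle
    where
    source≢ : ∀ {x y} → TransClosure R x y → v ≢ x
    source≢ [ e ] refl = no-out e
    source≢ (e ∷ _) refl = no-out e
    to : ∀ {x y} → v ≢ y → TransClosure R x y → TransClosure R' x y
    to v≢y [ e ] = [ transfer (source≢ [ e ]) v≢y e ]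
    to v≢y (e ∷ path) = transfer (source≢ [ e ]) (source≢ path) e ∷ to v≢y path

module SkewSymmetric {n} {q : Quiver n} (skew : IsQuiver q) where

  ⟶-asym : ∀ {a b} → a ⟶⟨ q ⟩ b → ¬ b ⟶⟨ q ⟩ a
  ⟶-asym {a} {b} a⟶b b⟶a =
    ℤP.<-asym b⟶a (subst (ℤ._< + 0) (sym (skew a b)) (ℤP.neg-mono-< a⟶b))

  ⟶⇒≢ : ∀ {a b} → a ⟶⟨ q ⟩ b → a ≢ b
  ⟶⇒≢ a⟶a refl = ⟶-asym a⟶a a⟶a

  ¬⟶⇒0≤ : ∀ {a b} → ¬ a ⟶⟨ q ⟩ b → + 0 ℤ.≤ q b a
  ¬⟶⇒0≤ {a} {b} ¬a⟶b = subst (+ 0 ℤ.≤_) (sym (skew a b)) (ℤP.neg-mono-≤ (ℤP.≮⇒≥ ¬a⟶b))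

  Abundant⇒2≤ : ∀ {S : VSet n} → Abundant q S →
    ∀ {a b} → S a → S b → a ⟶⟨ q ⟩ b → + 2 ℤ.≤ q a b
  Abundant⇒2≤ abundant {a} {b} sa sb a⟶b with abundant a b sa sb (⟶⇒≢ a⟶b)
  ... | inj₁ 2≤qab = 2≤qab
  ... | inj₂ 2≤qba = ⊥-elim (⟶-asym a⟶b (2≤⇒0< 2≤qba))

  ¬IsSink⇒out-neighbour : ∀ {v} → ¬ IsSink q v → Σ[ i ∈ Fin n ] v ⟶⟨ q ⟩ i
  ¬IsSink⇒out-neighbour {v} ¬sink =
    Prod.map₂ ℤP.≰⇒> (FP.¬∀⟶∃¬ n (λ j → q v j ℤ.≤ + 0) (λ j → q v j ℤP.≤? + 0) ¬sink)

  ¬IsSource⇒in-neighbour : ∀ {v} → ¬ IsSource q v → Σ[ j ∈ Fin n ] j ⟶⟨ q ⟩ v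
  ¬IsSource⇒in-neighbour {v} ¬source =
    Prod.map₂ ℤP.≰⇒> (FP.¬∀⟶∃¬ n (λ j → q j v ℤ.≤ + 0) (λ j → q j v ℤP.≤? + 0) ¬source)

KeyCondition-sym : ∀ {n} {q : Quiver n} {k k'} → KeyCondition q k k' → KeyCondition q k' k
KeyCondition-sym (k≢k' , sides) =
  ≢-sym k≢k' , λ i i≢k' i≢k → Sum.map Prod.swap Prod.swap (sides i i≢k i≢k')

module KeyNeighbours {n} {q : Quiver n} (skew : IsQuiver q) {k k'} (keyCondition : KeyCondition q k k')
                     {v} (v≢k : v ≢ k) (v≢k' : v ≢ k') where
  open SkewSymmetric skew

  out-neighbour-≢ : Σ[ i ∈ Fin n ] v ⟶⟨ q ⟩ i → Σ[ i ∈ Fin n ] (i ≢ k × v ⟶⟨ q ⟩ i)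
  out-neighbour-≢ (i , v⟶i) with i F.≟ k | proj₂ keyCondition v v≢k v≢k'
  ... | no i≢k | _ = i , i≢k , v⟶i
  ... | yes refl | inj₁ (k⟶v , _) = ⊥-elim (⟶-asym k⟶v v⟶i)
  ... | yes refl | inj₂ (_ , v⟶k') = k' , ≢-sym (proj₁ keyCondition) , v⟶k'

  in-neighbour-≢ : Σ[ j ∈ Fin n ] j ⟶⟨ q ⟩ v → Σ[ j ∈ Fin n ] (j ≢ k × j ⟶⟨ q ⟩ v)
  in-neighbour-≢ (j , j⟶v) with j F.≟ k | proj₂ keyCondition v v≢k v≢k'
  ... | no j≢k | _ = j , j≢k , j⟶v
  ... | yes refl | inj₁ (_ , k'⟶v) = k' , ≢-sym (proj₁ keyCondition) , k'⟶v
  ... | yes refl | inj₂ (v⟶k , _) = ⊥-elim (⟶-asym v⟶k j⟶v)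

NoTriangleAt : ∀ {n} → Quiver n → Fin n → Set
NoTriangleAt q v = ∀ a b → a ⟶⟨ q ⟩ b → b ⟶⟨ q ⟩ v → ¬ v ⟶⟨ q ⟩ a

¬triangle-off-key : ∀ {n} {q : Quiver n} {k k'} → k ≢ k' →
  Acyclic q (without k) → Acyclic q (without k') →
  ∀ {x y z} → x ⟶⟨ q ⟩ y → y ⟶⟨ q ⟩ z → z ⟶⟨ q ⟩ x → x ≢ k → x ≢ k' → y ≢ k → y ≢ k' → ⊥
¬triangle-off-key {k = k} k≢k' acyclic acyclic' {z = z} x⟶y y⟶z z⟶x x≢k x≢k' y≢k y≢k' with z F.≟ k
... | no z≢k = Acyclic⇒¬triangle acyclic x≢k y≢k z≢k x⟶y y⟶z z⟶x
... | yes refl = Acyclic⇒¬triangle acyclic' x≢k' y≢k' k≢k' x⟶y y⟶z z⟶x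

IsKey⇒NoTriangleAt : ∀ {n} {q : Quiver n} {k k' v} → IsQuiver q → IsKey q k k' →
  v ≢ k → v ≢ k' → NoTriangleAt q v
-- k and k' lie on the same side of v, so besides v a second vertex of the triangle avoids both.
IsKey⇒NoTriangleAt {q = q} {k} {k'} {v} skew ((k≢k' , sides) , (_ , acyclic) , (_ , acyclic'))
                   v≢k v≢k' a b a⟶b b⟶v v⟶a =
  Sum.[ (λ (k⟶v , k'⟶v) → ¬triangle v⟶a a⟶b b⟶v v≢k v≢k'
                               (λ { refl → ⟶-asym k⟶v v⟶a }) (λ { refl → ⟶-asym k'⟶v v⟶a }))
      , (λ (v⟶k , v⟶k') → ¬triangle b⟶v v⟶a a⟶b
                               (λ { refl → ⟶-asym b⟶v v⟶k }) (λ { refl → ⟶-asym b⟶v v⟶k' }) v≢k v≢k')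
      ] (sides v v≢k v≢k')
  where
  open SkewSymmetric skew
  ¬triangle : ∀ {x y z} → x ⟶⟨ q ⟩ y → y ⟶⟨ q ⟩ z → z ⟶⟨ q ⟩ x →
    x ≢ k → x ≢ k' → y ≢ k → y ≢ k' → ⊥
  ¬triangle = ¬triangle-off-key k≢k' acyclic acyclic'

twoPaths : ∀ {n} → Quiver n → Fin n → Fin n → Fin n → ℕ
twoPaths q a v b = posℕ (q a v) ℕ.* posℕ (q v b)

module _ {n} {q : Quiver n} {v : Fin n} where

  twoPaths-≡0 : ∀ {a b} → (a ⟶⟨ q ⟩ v → ¬ v ⟶⟨ q ⟩ b) → twoPaths q a v b ≡ 0
  twoPaths-≡0 {a} {b} ¬path with + 0 ℤP.<? q a v
  ... | no ¬a⟶v = cong (ℕ._* posℕ (q v b)) (posℕ-nonpositive ¬a⟶v)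
  ... | yes a⟶v = trans (cong (posℕ (q a v) ℕ.*_) (posℕ-nonpositive (¬path a⟶v))) (ℕP.*-zeroʳ (posℕ (q a v)))

  twoPaths-positive : ∀ {a b} → a ⟶⟨ q ⟩ v → v ⟶⟨ q ⟩ b → 0 ℕ.< twoPaths q a v b
  twoPaths-positive a⟶v v⟶b = ℕP.*-mono-≤ (posℕ-positive a⟶v) (posℕ-positive v⟶b)

  μ-at : IsQuiver q → ∀ {a b} → v ≡ a ⊎ v ≡ b → μ v q a b ≡ q b a
  μ-at skew {a} {b} v∈ab with v F.≟ a | v F.≟ b | v∈ab
  ... | yes _ | _ | _ = sym (skew a b)
  ... | no _ | yes _ | _ = sym (skew a b)
  ... | no v≢a | no _ | inj₁ v≡a = ⊥-elim (v≢a v≡a)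
  ... | no _ | no v≢b | inj₂ v≡b = ⊥-elim (v≢b v≡b)

  μ-at-⟶ : IsQuiver q → ∀ {a b} → v ≡ a ⊎ v ≡ b → b ⟶⟨ q ⟩ a → a ⟶⟨ μ v q ⟩ b
  μ-at-⟶ skew v∈ab = subst (+ 0 ℤ.<_) (sym (μ-at skew v∈ab))

  μ-at-⟶⁻ : IsQuiver q → ∀ {a b} → v ≡ a ⊎ v ≡ b → a ⟶⟨ μ v q ⟩ b → b ⟶⟨ q ⟩ a
  μ-at-⟶⁻ skew v∈ab = subst (+ 0 ℤ.<_) (μ-at skew v∈ab)

  arrowsBetween-μ-at : IsQuiver q → ∀ {a b} → v ≡ a ⊎ v ≡ b →
    arrowsBetween (μ v q) a b ≡ arrowsBetween q a b
  arrowsBetween-μ-at skew {a} {b} v∈ab = begin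
    posℕ (μ v q a b) ℕ.+ posℕ (μ v q b a) ≡⟨ cong₂ ℕ._+_ (cong posℕ (μ-at skew v∈ab))
                                                       (cong posℕ (μ-at skew (Sum.swap v∈ab))) ⟩
    posℕ (q b a) ℕ.+ posℕ (q a b)         ≡⟨ ℕP.+-comm (posℕ (q b a)) (posℕ (q a b)) ⟩
    posℕ (q a b) ℕ.+ posℕ (q b a)         ∎
    where open ≡-Reasoning

  μ-away : ∀ {a b} → v ≢ a → v ≢ b → μ v q a b ≡ q a b ℤ.+ + twoPaths q a v b ℤ.- + twoPaths q b v a
  μ-away {a} {b} v≢a v≢b with v F.≟ a | v F.≟ b
  ... | yes v≡a | _ = ⊥-elim (v≢a v≡a)
  ... | no _ | yes v≡b = ⊥-elim (v≢b v≡b)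
  ... | no _ | no _ =
    cong₂ (λ s t → q a b ℤ.+ s ℤ.- t) (pos*pos (q a v) (q v b)) (pos*pos (q b v) (q v a))
    where
    pos*pos : ∀ x y → pos x ℤ.* pos y ≡ + (posℕ x ℕ.* posℕ y)
    pos*pos x y = trans (cong₂ ℤ._*_ (pos≡+posℕ x) (pos≡+posℕ y)) (sym (ℤP.pos-* (posℕ x) (posℕ y)))

  μ-away-+ : ∀ {a b} → v ≢ a → v ≢ b → twoPaths q b v a ≡ 0 → μ v q a b ≡ q a b ℤ.+ + twoPaths q a v b
  μ-away-+ {a} {b} v≢a v≢b no-return = begin
    μ v q a b                                            ≡⟨ μ-away v≢a v≢b ⟩
    q a b ℤ.+ + twoPaths q a v b ℤ.- + twoPaths q b v a  ≡⟨ cong (λ t → q a b ℤ.+ + twoPaths q a v b ℤ.- + t) no-return ⟩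
    q a b ℤ.+ + twoPaths q a v b ℤ.+ + 0                 ≡⟨ ℤP.+-identityʳ _ ⟩
    q a b ℤ.+ + twoPaths q a v b                         ∎
    where open ≡-Reasoning

  μ-away-≡ : ∀ {a b} → v ≢ a → v ≢ b → twoPaths q a v b ≡ 0 → twoPaths q b v a ≡ 0 → μ v q a b ≡ q a b
  μ-away-≡ {a} {b} v≢a v≢b no-path no-return =
    trans (μ-away-+ v≢a v≢b no-return)
          (trans (cong (λ t → q a b ℤ.+ + t) no-path) (ℤP.+-identityʳ (q a b)))

  μ-fixes-same-side : IsQuiver q → ∀ {a b} → (a ⟶⟨ q ⟩ v × b ⟶⟨ q ⟩ v) ⊎ (v ⟶⟨ q ⟩ a × v ⟶⟨ q ⟩ b) →
    μ v q a b ≡ q a b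
  μ-fixes-same-side skew (inj₁ (a⟶v , b⟶v)) =
    μ-away-≡ (≢-sym (⟶⇒≢ a⟶v)) (≢-sym (⟶⇒≢ b⟶v))
      (twoPaths-≡0 (λ _ → ⟶-asym b⟶v)) (twoPaths-≡0 (λ _ → ⟶-asym a⟶v))
    where open SkewSymmetric skew
  μ-fixes-same-side skew (inj₂ (v⟶a , v⟶b)) =
    μ-away-≡ (⟶⇒≢ v⟶a) (⟶⇒≢ v⟶b)
      (twoPaths-≡0 (λ a⟶v _ → ⟶-asym v⟶a a⟶v)) (twoPaths-≡0 (λ b⟶v _ → ⟶-asym v⟶b b⟶v))
    where open SkewSymmetric skew

at-or-away : ∀ {n} (v a b : Fin n) → (v ≡ a ⊎ v ≡ b) ⊎ (v ≢ a × v ≢ b)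
at-or-away v a b with v F.≟ a | v F.≟ b
... | yes v≡a | _ = inj₁ (inj₁ v≡a)
... | no _ | yes v≡b = inj₁ (inj₂ v≡b)
... | no v≢a | no v≢b = inj₂ (v≢a , v≢b)

module SinkOrSource {n} {q : Quiver n} (skew : IsQuiver q) {v : Fin n}
                    (sink⊎source : IsSink q v ⊎ IsSource q v) where

  twoPaths-through-≡0 : ∀ a b → twoPaths q a v b ≡ 0
  twoPaths-through-≡0 a b = Sum.[ (λ sink → twoPaths-≡0 {q = q} {v} (λ _ v⟶b → ℤP.<⇒≱ v⟶b (sink b)))
                                , (λ source → twoPaths-≡0 {q = q} {v} (λ a⟶v _ → ℤP.<⇒≱ a⟶v (source a)))
                                ] sink⊎source

  μ-fixes-away : ∀ {a b} → v ≢ a → v ≢ b → μ v q a b ≡ q a b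
  μ-fixes-away {a} {b} v≢a v≢b = μ-away-≡ v≢a v≢b (twoPaths-through-≡0 a b) (twoPaths-through-≡0 b a)

  numArrows-μ : numArrows (μ v q) ≡ numArrows q
  numArrows-μ = numArrows-cong {q = q} {μ v q} arrowsBetween-μ
    where
    arrowsBetween-μ : ∀ a b → arrowsBetween (μ v q) a b ≡ arrowsBetween q a b
    arrowsBetween-μ a b with at-or-away v a b
    ... | inj₁ v∈ab = arrowsBetween-μ-at skew v∈ab
    ... | inj₂ (v≢a , v≢b) =
      cong₂ ℕ._+_ (cong posℕ (μ-fixes-away v≢a v≢b)) (cong posℕ (μ-fixes-away v≢b v≢a))

  unchanged-arrow : ∀ {S a b} → v ≢ a → v ≢ b → Arrow (μ v q) S a b → Arrow q S a b
  unchanged-arrow v≢a v≢b (sa , sb , a⟶b) = sa , sb , subst (+ 0 ℤ.<_) (μ-fixes-away v≢a v≢b) a⟶b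

  -- In μ_v Q the vertex v is again a sink or a source, so no cycle passes through it.
  Acyclic-μ : ∀ {S} → Acyclic q S → Acyclic (μ v q) S
  Acyclic-μ acyclic x cycle = acyclic x (Sum.[ avoiding-sink , avoiding-source ] sink⊎source)
    where
    avoiding-sink : IsSink q v → TransClosure (Arrow q _) x x
    avoiding-sink sink = cycle-avoiding-sink v unchanged-arrow
      (λ (_ , _ , a⟶v) → ℤP.<⇒≱ (μ-at-⟶⁻ skew (inj₂ refl) a⟶v) (sink _)) cycle
    avoiding-source : IsSource q v → TransClosure (Arrow q _) x x
    avoiding-source source = cycle-avoiding-source v unchanged-arrow
      (λ (_ , _ , v⟶b) → ℤP.<⇒≱ (μ-at-⟶⁻ skew (inj₁ refl) v⟶b) (source _)) cycle

module NoTriangle {n} {q : Quiver n} (skew : IsQuiver q) {v : Fin n} (no-triangle : NoTriangleAt q v) where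
  open SkewSymmetric skew

  μ-away-⟶ : ∀ {a b} → v ≢ a → v ≢ b → a ⟶⟨ q ⟩ b → μ v q a b ≡ q a b ℤ.+ + twoPaths q a v b
  μ-away-⟶ {a} {b} v≢a v≢b a⟶b =
    μ-away-+ v≢a v≢b (twoPaths-≡0 {q = q} {v} (λ b⟶v v⟶a → no-triangle a b a⟶b b⟶v v⟶a))

  μ-away-grows : ∀ {a b} → v ≢ a → v ≢ b → a ⟶⟨ q ⟩ b → q a b ℤ.≤ μ v q a b
  μ-away-grows {a} {b} v≢a v≢b a⟶b =
    subst (q a b ℤ.≤_) (sym (μ-away-⟶ v≢a v≢b a⟶b)) (ℤP.i≤i+j (q a b) (+ twoPaths q a v b))

  μ-away-keeps-⟶ : ∀ {a b} → v ≢ a → v ≢ b → a ⟶⟨ q ⟩ b → a ⟶⟨ μ v q ⟩ b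
  μ-away-keeps-⟶ v≢a v≢b a⟶b = ℤP.<-≤-trans a⟶b (μ-away-grows v≢a v≢b a⟶b)

  posℕ-μ-away : ∀ {a b} → v ≢ a → v ≢ b → posℕ (q a b) ℕ.≤ posℕ (μ v q a b)
  posℕ-μ-away {a} {b} v≢a v≢b with + 0 ℤP.<? q a b
  ... | yes a⟶b = posℕ-mono-≤ (μ-away-grows v≢a v≢b a⟶b)
  ... | no ¬a⟶b = subst (ℕ._≤ posℕ (μ v q a b)) (sym (posℕ-nonpositive ¬a⟶b)) z≤n

  arrowsBetween-μ-≤ : ∀ a b → arrowsBetween q a b ℕ.≤ arrowsBetween (μ v q) a b
  arrowsBetween-μ-≤ a b with at-or-away v a b
  ... | inj₁ v∈ab = ℕP.≤-reflexive (sym (arrowsBetween-μ-at skew v∈ab))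
  ... | inj₂ (v≢a , v≢b) = ℕP.+-mono-≤ (posℕ-μ-away v≢a v≢b) (posℕ-μ-away v≢b v≢a)

  arrowsBetween-μ-< : ∀ {a b} → b ⟶⟨ q ⟩ v → v ⟶⟨ q ⟩ a → arrowsBetween q b a ℕ.< arrowsBetween (μ v q) b a
  arrowsBetween-μ-< {a} {b} b⟶v v⟶a = ℕP.+-mono-<-≤ posℕ-grows (posℕ-μ-away v≢a v≢b)
    where
    v≢a : v ≢ a
    v≢a = ⟶⇒≢ v⟶a
    v≢b : v ≢ b
    v≢b = ≢-sym (⟶⇒≢ b⟶v)
    added : μ v q b a ≡ q b a ℤ.+ + twoPaths q b v a
    added = μ-away-+ v≢b v≢a (twoPaths-≡0 {q = q} {v} (λ a⟶v _ → ⟶-asym v⟶a a⟶v))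
    posℕ-grows : posℕ (q b a) ℕ.< posℕ (μ v q b a)
    posℕ-grows = subst (λ x → posℕ (q b a) ℕ.< posℕ x) (sym added)
      (posℕ-<-+ (twoPaths q b v a) (¬⟶⇒0≤ (λ a⟶b → no-triangle a b a⟶b b⟶v v⟶a))
                (twoPaths-positive {q = q} b⟶v v⟶a))

  numArrows-μ-< : ¬ IsSink q v → ¬ IsSource q v → numArrows q ℕ.< numArrows (μ v q)
  numArrows-μ-< ¬sink ¬source =
    let (a , v⟶a) = ¬IsSink⇒out-neighbour ¬sink
        (b , b⟶v) = ¬IsSource⇒in-neighbour ¬source
    in numArrows-< {q = q} {μ v q} arrowsBetween-μ-≤ b a (arrowsBetween-μ-< b⟶v v⟶a)

  two-arrows-μ : ∀ {a b} → + 2 ℤ.≤ q a b → (+ 2 ℤ.≤ μ v q a b) ⊎ (+ 2 ℤ.≤ μ v q b a)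
  two-arrows-μ {a} {b} 2≤qab with at-or-away v a b
  ... | inj₁ v∈ab = inj₂ (subst (+ 2 ℤ.≤_) (sym (μ-at skew (Sum.swap v∈ab))) 2≤qab)
  ... | inj₂ (v≢a , v≢b) = inj₁ (ℤP.≤-trans 2≤qab (μ-away-grows v≢a v≢b (2≤⇒0< 2≤qab)))

  Abundant-μ : ∀ {S} → Abundant q S → Abundant (μ v q) S
  Abundant-μ abundant a b sa sb a≢b with abundant a b sa sb a≢b
  ... | inj₁ 2≤qab = two-arrows-μ 2≤qab
  ... | inj₂ 2≤qba = Sum.swap (two-arrows-μ 2≤qba)

  Abundant⇒2≤-shortcut : ∀ {S} → Abundant q S → ∀ {a b} → S a → S b →
    a ⟶⟨ q ⟩ v → v ⟶⟨ q ⟩ b → + 2 ℤ.≤ q a b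
  Abundant⇒2≤-shortcut abundant {a} {b} sa sb a⟶v v⟶b with abundant a b sa sb (λ { refl → ⟶-asym a⟶v v⟶b })
  ... | inj₁ 2≤qab = 2≤qab
  ... | inj₂ 2≤qba = ⊥-elim (no-triangle b a (2≤⇒0< 2≤qba) a⟶v v⟶b)

  IsForkWith-μ : ∀ {S} → S v → Abundant q S → Acyclic q S →
    ∀ {i j} → S i → v ⟶⟨ q ⟩ i → S j → j ⟶⟨ q ⟩ v → IsForkWith (μ v q) S v
  IsForkWith-μ {S} sv abundant acyclic {i} {j} si v⟶i sj j⟶v =
    sv , Abundant-μ abundant , oriented-cycle , return-bounds , acyclic-in , acyclic-out
    where
    p : Quiver n
    p = μ v q
    oriented-cycle : ¬ Acyclic p S
    oriented-cycle acyclic-p = acyclic-p j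
      ( (sj , si , μ-away-keeps-⟶ (≢-sym (⟶⇒≢ j⟶v)) (⟶⇒≢ v⟶i)
                     (2≤⇒0< (Abundant⇒2≤-shortcut abundant sj si j⟶v v⟶i)))
      ∷ (si , sv , μ-at-⟶ skew (inj₂ refl) v⟶i)
      ∷ [ sv , sj , μ-at-⟶ skew (inj₁ refl) j⟶v ])
    return-bounds : ∀ a b → InNbr p S v a → OutNbr p S v b → (p a v ℤ.< p b a) × (p v b ℤ.< p b a)
    return-bounds a b (sa , a⟶ₚv) (sb , v⟶ₚb) =
        subst₂ ℤ._<_ (sym (μ-at skew (inj₂ refl))) (sym added) (proj₁ bounds)
      , subst₂ ℤ._<_ (sym (μ-at skew (inj₁ refl))) (sym added) (proj₂ bounds)
      where
      v⟶a : v ⟶⟨ q ⟩ a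
      v⟶a = μ-at-⟶⁻ skew (inj₂ refl) a⟶ₚv
      b⟶v : b ⟶⟨ q ⟩ v
      b⟶v = μ-at-⟶⁻ skew (inj₁ refl) v⟶ₚb
      2≤qba : + 2 ℤ.≤ q b a
      2≤qba = Abundant⇒2≤-shortcut abundant sb sa b⟶v v⟶a
      added : p b a ≡ q b a ℤ.+ + twoPaths q b v a
      added = μ-away-⟶ (≢-sym (⟶⇒≢ b⟶v)) (⟶⇒≢ v⟶a) (2≤⇒0< 2≤qba)
      bounds : (q v a ℤ.< q b a ℤ.+ + twoPaths q b v a) × (q b v ℤ.< q b a ℤ.+ + twoPaths q b v a)
      bounds = <-+-posℕ-* (ℤP.≤-trans (+≤+ z≤n) 2≤qba)
                 (Abundant⇒2≤ abundant sv sa v⟶a) (Abundant⇒2≤ abundant sb sv b⟶v)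
    acyclic-in : Acyclic p (InNbr p S v)
    acyclic-in = Acyclic-transfer proj₁
      (λ (_ , a⟶ₚv) (_ , b⟶ₚv) → subst (+ 0 ℤ.<_) (μ-fixes-same-side {q = q} {v} skew
         (inj₂ (μ-at-⟶⁻ skew (inj₂ refl) a⟶ₚv , μ-at-⟶⁻ skew (inj₂ refl) b⟶ₚv))))
      acyclic
    acyclic-out : Acyclic p (OutNbr p S v)
    acyclic-out = Acyclic-transfer proj₁
      (λ (_ , v⟶ₚa) (_ , v⟶ₚb) → subst (+ 0 ℤ.<_) (μ-fixes-same-side {q = q} {v} skew
         (inj₁ (μ-at-⟶⁻ skew (inj₁ refl) v⟶ₚa , μ-at-⟶⁻ skew (inj₁ refl) v⟶ₚb))))
      acyclic

  IsForkWith-μ-without : ∀ {k k'} → KeyCondition q k k' → v ≢ k → v ≢ k' →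
    Abundant q (without k) → Acyclic q (without k) → ¬ IsSink q v → ¬ IsSource q v →
    IsForkWith (μ v q) (without k) v
  IsForkWith-μ-without keyCondition v≢k v≢k' abundant acyclic ¬sink ¬source =
    let (i , i≢k , v⟶i) = out-neighbour-≢ (¬IsSink⇒out-neighbour ¬sink)
        (j , j≢k , j⟶v) = in-neighbour-≢ (¬IsSource⇒in-neighbour ¬source)
    in IsForkWith-μ v≢k abundant acyclic i≢k v⟶i j≢k j⟶v
    where open KeyNeighbours skew keyCondition v≢k v≢k'

  KeyCondition-μ : ∀ {k k'} → v ≢ k → v ≢ k' → KeyCondition q k k' → KeyCondition (μ v q) k k'
  KeyCondition-μ {k} {k'} v≢k v≢k' (k≢k' , sides) =
    k≢k' , λ i i≢k i≢k' → reorient (v F.≟ i) (sides i i≢k i≢k')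
    where
    reorient : ∀ {i} → Dec (v ≡ i) → (k ⟶⟨ q ⟩ i × k' ⟶⟨ q ⟩ i) ⊎ (i ⟶⟨ q ⟩ k × i ⟶⟨ q ⟩ k') →
      (k ⟶⟨ μ v q ⟩ i × k' ⟶⟨ μ v q ⟩ i) ⊎ (i ⟶⟨ μ v q ⟩ k × i ⟶⟨ μ v q ⟩ k')
    reorient (yes v≡i) (inj₁ (k⟶i , k'⟶i)) =
      inj₂ (μ-at-⟶ skew (inj₁ v≡i) k⟶i , μ-at-⟶ skew (inj₁ v≡i) k'⟶i)
    reorient (yes v≡i) (inj₂ (i⟶k , i⟶k')) =
      inj₁ (μ-at-⟶ skew (inj₂ v≡i) i⟶k , μ-at-⟶ skew (inj₂ v≡i) i⟶k')
    reorient (no v≢i) (inj₁ (k⟶i , k'⟶i)) =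
      inj₁ (μ-away-keeps-⟶ v≢k v≢i k⟶i , μ-away-keeps-⟶ v≢k' v≢i k'⟶i)
    reorient (no v≢i) (inj₂ (i⟶k , i⟶k')) =
      inj₂ (μ-away-keeps-⟶ v≢i v≢k i⟶k , μ-away-keeps-⟶ v≢i v≢k' i⟶k')

lemma4p10 : ∀ {n} (q : Quiver n) (k k' r : Fin n) →
    IsQuiver q → IsKey q k k' → r ≢ k → r ≢ k' →
    ((¬ IsSink q r × ¬ IsSource q r) →
       IsPreFork (μ r q) r k k' × numArrows q < numArrows (μ r q) × μ r q k k' ≡ q k k')
    × ((IsSink q r ⊎ IsSource q r) →
       IsKey (μ r q) k k' × numArrows (μ r q) ≡ numArrows q × μ r q k k' ≡ q k k')
lemma4p10 q k k' r skew key@(keyCondition , (abundant , acyclic) , (abundant' , acyclic')) r≢k r≢k' =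
  ( λ (¬sink , ¬source) →
        ( keyCondition-μ
        , IsForkWith-μ-without keyCondition r≢k r≢k' abundant acyclic ¬sink ¬source
        , IsForkWith-μ-without (KeyCondition-sym keyCondition) r≢k' r≢k abundant' acyclic' ¬sink ¬source )
      , numArrows-μ-< ¬sink ¬source
      , μ-fixes-kk' )
  , λ sink⊎source → let open SinkOrSource skew sink⊎source in
        ( keyCondition-μ
        , (Abundant-μ abundant , Acyclic-μ acyclic)
        , (Abundant-μ abundant' , Acyclic-μ acyclic') )
      , numArrows-μ
      , μ-fixes-kk'
  where
  open NoTriangle skew (IsKey⇒NoTriangleAt skew key r≢k r≢k')
  keyCondition-μ : KeyCondition (μ r q) k k'
  keyCondition-μ = KeyCondition-μ r≢k r≢k' keyCondition
  μ-fixes-kk' : μ r q k k' ≡ q k k'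
  μ-fixes-kk' = μ-fixes-same-side skew (proj₂ keyCondition r r≢k r≢k')
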